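{- Let $G=(V,E)$ be a finite connected undirected graph with $N$ vertices, with random walk, set function $F$, vertex cover size $C$, and rank function $\rho$ as described in the context. For $0<c\le 1$ and $0<K\le N$ let $L_{c,K}=\{A\subseteq V: A\neq\emptyset,\ |A|\le K,\ \rho(A)\ge c\}$. Then $L_{c,K}$ satisfies the following augmentation property: for all $X,Y\in L_{c,K}$ with $|X|>|Y|$, there exists $x\in X\setminus Y$ such that $Y\cup\{x\}\in L_{c,K}$.
   Context: $G=(V,E)$ is a connected undirected graph with $N$ vertices. The random walk $(X_n)_{n\ge0}$ on $V$ has transition probabilities $p(i,j)=1/\deg(i)$ if $(i,j)\in E$ and $p(i,j)=0$ otherwise; the resulting Markov chain is assumed irreducible and aperiodic. For $A\subseteq V$, $T_A=\min\{n>0 : X_n\in A\}$, $h(i,A)=\mathbb{E}_i[T_A]$ for a walk started at $i$, and $F(A)=\sum_{i\notin A}h(i,A)$. Fix a vertex cover of $G$ with $C$ vertices. Let $F_{max}=\max\{F(A): \emptyset\ne A\subseteq V,\ |A|\le C\}$ and $F_{min}=\min\{F(A): \emptyset\ne A\subseteq V,\ |A|\le C\}$, and assume $F_{max}\neq F_{min}$. The rank of a nonempty set $A\subseteq V$ is $\rho(A)=\dfrac{F_{max}-F(A)}{F_{max}-F_{min}}$.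
   Formalization: The threshold c, with 0<c≤1, ranges over the rationals. -}

module Defs where

open import Data.Nat as ℕ using (ℕ; zero; suc)
open import Data.Nat.Divisibility using (_∣_)
open import Data.Integer using (+_)
open import Data.Fin using (Fin; zero; suc)
open import Data.Fin.Subset using (Subset; _∈_; _∉_; ∣_∣; Nonempty; _∪_; ⁅_⁆)
open import Data.Vec using (lookup)
open import Data.Bool using (Bool; true; false; if_then_else_)
open import Data.Rational using (ℚ; 0ℚ; 1ℚ; _+_; _-_; _*_; _/_; _≤_; 1/_; ≢-nonZero)
import Data.Rational.Properties as ℚP
open import Algebra.Properties.Group ℚP.+-0-group using (x∙y⁻¹≈ε⇒x≈y)
open import Data.Product using (Σ; ∃; _×_; _,_)
open import Data.Sum using (_⊎_)
open import Relation.Binary.PropositionalEquality using (_≡_; _≢_)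

Graph : ℕ → Set
Graph N = Fin N → Fin N → Bool

IsSimpleUndirected : ∀ {N} → Graph N → Set
IsSimpleUndirected {N} G =
  ((i j : Fin N) → G i j ≡ G j i) × ((i : Fin N) → G i i ≡ false)

data Walk {N : ℕ} (G : Graph N) : Fin N → Fin N → ℕ → Set where
  nil  : ∀ {i} → Walk G i i 0
  cons : ∀ {i j k n} → G i j ≡ true → Walk G j k n → Walk G i k (suc n)

Connected : ∀ {N} → Graph N → Set
Connected {N} G = (i j : Fin N) → ∃ λ n → Walk G i j n

-- Aperiodicity of the random walk: for every vertex i, the gcd of
-- {n ≥ 1 : p^n(i,i) > 0} is 1, i.e. every common divisor of the lengths
-- of closed walks at i equals 1 (p^n(i,i) > 0 iff a closed walk of length n exists).
Aperiodic : ∀ {N} → Graph N → Set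
Aperiodic {N} G = (i : Fin N) (d : ℕ) →
  ((n : ℕ) → Walk G i i (suc n) → d ∣ suc n) → d ≡ 1

VertexCover : ∀ {N} → Graph N → ℕ → Subset N → Set
VertexCover {N} G C S =
  (∣ S ∣ ≡ C) × ((i j : Fin N) → G i j ≡ true → (i ∈ S) ⊎ (j ∈ S))

sumℚ : ∀ {n} → (Fin n → ℚ) → ℚ
sumℚ {zero}  f = 0ℚ
sumℚ {suc n} f = f zero + sumℚ (λ i → f (suc i))

countℕ : ∀ {n} → (Fin n → Bool) → ℕ
countℕ {zero}  f = 0
countℕ {suc n} f = (if f zero then 1 else 0) ℕ.+ countℕ (λ i → f (suc i))

degree : ∀ {N} → Graph N → Fin N → ℕ
degree G i = countℕ (G i)

-- Transition probability p(i,j) = 1/deg(i) if (i,j) ∈ E, else 0.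
-- (If deg i = 0 there are no edges at i and p(i,·) = 0.)
invDeg : ℕ → ℚ
invDeg zero    = 0ℚ
invDeg (suc k) = (+ 1) / suc k

trans-prob : ∀ {N} → Graph N → Fin N → Fin N → ℚ
trans-prob G i j = if G i j then invDeg (degree G i) else 0ℚ

-- h is the expected hitting time function h(i,A) = E_i[T_A] for nonempty A,
-- T_A = min{n > 0 : X_n ∈ A}.  It is characterized (for a connected graph
-- and nonempty A this system has a unique solution) by first-step analysis:
-- for i ∉ A,  h(i,A) = 1 + Σ_j p(i,j) h(j,A)  with h(j,A) counted as 0 for j ∈ A.
IsHittingTime : ∀ {N} → Graph N → (Subset N → Fin N → ℚ) → Set
IsHittingTime {N} G h = (A : Subset N) → Nonempty A → (i : Fin N) → i ∉ A →
  h A i ≡ 1ℚ + sumℚ (λ j → trans-prob G i j * (if lookup A j then 0ℚ else h A j))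

Fsum : ∀ {N} → (Subset N → Fin N → ℚ) → Subset N → ℚ
Fsum h A = sumℚ (λ i → if lookup A i then 0ℚ else h A i)

Admissible : ∀ {N} → ℕ → Subset N → Set
Admissible C A = Nonempty A × (∣ A ∣ ℕ.≤ C)

IsMax : ∀ {N} → ℕ → (Subset N → ℚ) → ℚ → Set
IsMax {N} C F m = (∃ λ (A : Subset N) → Admissible C A × (F A ≡ m))
                × ((A : Subset N) → Admissible C A → F A ≤ m)

IsMin : ∀ {N} → ℕ → (Subset N → ℚ) → ℚ → Set
IsMin {N} C F m = (∃ λ (A : Subset N) → Admissible C A × (F A ≡ m))
                × ((A : Subset N) → Admissible C A → m ≤ F A)

diff≢0 : ∀ {p q : ℚ} → p ≢ q → (p - q) ≢ 0ℚ
diff≢0 {p} {q} p≢q e = p≢q (x∙y⁻¹≈ε⇒x≈y p q e)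

rank : ∀ {N} (F : Subset N → ℚ) (Fmax Fmin : ℚ) → Fmax ≢ Fmin → Subset N → ℚ
rank F Fmax Fmin ne A =
  (Fmax - F A) * (1/_ (Fmax - Fmin) {{≢-nonZero (diff≢0 ne)}})

InL : ∀ {N} → (Subset N → ℚ) → ℚ → ℕ → Subset N → Set
InL ρ c K A = Nonempty A × (∣ A ∣ ℕ.≤ K) × (c ≤ ρ A)

{-# OPTIONS --safe #-}
module Submission where

-- The rank is an increasing function of −F, so it suffices that F is antitone:
-- A ⊆ B implies F(B) ≤ F(A). Extending h(·,A) by 0 on A, the difference
-- d = h(·,A) − h(·,B) is harmonic off B and nonnegative on B; by the minimum
-- principle for the random walk on a connected graph it is nonnegative everywhere.
-- The augmentation property then holds for any monotone rank: add to Y any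
-- x ∈ X ∖ Y, which exists since |Y| < |X|.

open import Defs
open import Data.Nat using (ℕ; _<_; _≤_)
open import Data.Fin using (Fin)
open import Data.Fin.Subset using (Subset; _∈_; _∉_; ∣_∣; _∪_; ⁅_⁆)
open import Data.Rational using (ℚ; 0ℚ; 1ℚ) renaming (_<_ to _<ℚ_; _≤_ to _≤ℚ_)
open import Data.Product using (∃; _×_)
open import Relation.Binary.PropositionalEquality using (_≢_)

open import Data.Bool using (Bool; true; false; if_then_else_)
open import Data.Empty using (⊥; ⊥-elim)
open import Data.Fin using (zero; suc)
open import Data.Fin.Properties using (any?)
open import Data.Fin.Subset using (Nonempty; _⊆_; inside; outside)
open import Data.Fin.Subset.Properties
  using (_∈?_; x∈⁅x⁆; ∣⁅x⁆∣≡1; p⊆p∪q; x∈p∪q⁺; p⊆q⇒∣p∣≤∣q∣)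
open import Data.Integer as ℤ using (ℤ)
open import Data.Integer.Tactic.RingSolver using (solve-∀)
open import Data.List using (allFin)
open import Data.List.Membership.Propositional.Properties using (∈-allFin)
import Data.List.Relation.Unary.All as All
open import Data.Nat as ℕ using (zero; suc)
import Data.Nat.Coprimality as Coprime
import Data.Nat.Properties as ℕP
open import Data.Product using (_,_; proj₂)
open import Data.Rational as ℚ using (mkℚ; _+_; _*_; _-_; -_; 1/_; NonNegative)
import Data.Rational.Properties as ℚP
open import Data.Rational.Solver using (module +-*-Solver)
import Data.Rational.Unnormalised as ℚᵘ
import Data.Rational.Unnormalised.Properties as ℚᵘP
open import Data.Sum using (inj₂)
open import Data.Vec using ([]; _∷_; lookup)
open import Data.Vec.Properties using (lookup⇒[]=; []=⇒lookup)
open import Function using (_∘_)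
open import Relation.Binary.Bundles using (DecTotalOrder)
open import Relation.Binary.PropositionalEquality
  using (_≡_; refl; sym; trans; cong; cong₂; subst; subst₂; module ≡-Reasoning)
open import Relation.Nullary using (yes; no; ¬?; _×-dec_)
open import Relation.Nullary.Decidable using (decidable-stable)

open import Data.List.Extrema (DecTotalOrder.totalOrder ℚP.≤-decTotalOrder)
  using (argmin; f[argmin]≤f[xs])
open +-*-Solver using (solve; con; _:+_; _:-_; _:*_; _:=_)

fromℕ : ℕ → ℚ
fromℕ n = mkℚ (ℤ.+ n) 0 (Coprime.sym (Coprime.1-coprimeTo n))

fromℕ-suc : ∀ n → fromℕ (suc n) ≡ 1ℚ + fromℕ n
fromℕ-suc n = ℚP.toℚᵘ-injective (ℚᵘP.≃-sym (ℚᵘP.≃-trans (ℚP.toℚᵘ-homo-+ 1ℚ (fromℕ n))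
  (ℚᵘ.*≡* (cross-multiplied (ℤ.+ n)))))
  where
  cross-multiplied : ∀ (x : ℤ) →
    (ℤ.1ℤ ℤ.* ℤ.1ℤ ℤ.+ x ℤ.* ℤ.1ℤ) ℤ.* ℤ.1ℤ ≡ (ℤ.1ℤ ℤ.+ x) ℤ.* (ℤ.1ℤ ℤ.* ℤ.1ℤ)
  cross-multiplied = solve-∀

invDeg-suc : ∀ k → invDeg (suc k) ≡ 1/ fromℕ (suc k)
invDeg-suc k = ℚP.normalize-coprime (Coprime.1-coprimeTo (suc k))

fromℕ*invDeg : ∀ k → fromℕ (suc k) * invDeg (suc k) ≡ 1ℚ
fromℕ*invDeg k rewrite invDeg-suc k = ℚP.*-inverseʳ (fromℕ (suc k))

invDeg-nonNeg : ∀ n → 0ℚ ≤ℚ invDeg n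
invDeg-nonNeg zero    = ℚP.≤-refl
invDeg-nonNeg (suc k) = ℚP.nonNegative⁻¹ _ {{ℚP.normalize-nonNeg 1 (suc k)}}

invDeg-pos : ∀ k → 0ℚ <ℚ invDeg (suc k)
invDeg-pos k = ℚP.positive⁻¹ _ {{ℚP.normalize-pos 1 (suc k)}}

0≤p-q⇒q≤p : ∀ {p q} → 0ℚ ≤ℚ p - q → q ≤ℚ p
0≤p-q⇒q≤p {p} {q} 0≤p-q = subst₂ _≤ℚ_ (ℚP.+-identityˡ q) (p-q+q≡p p q) (ℚP.+-monoˡ-≤ q 0≤p-q)
  where
  p-q+q≡p : ∀ p q → (p - q) + q ≡ p
  p-q+q≡p = solve 2 (λ p q → (p :- q) :+ q := p) refl

q≤p⇒0≤p-q : ∀ {p q} → q ≤ℚ p → 0ℚ ≤ℚ p - q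
q≤p⇒0≤p-q {p} {q} q≤p = subst (_≤ℚ p - q) (ℚP.+-inverseʳ q) (ℚP.+-monoˡ-≤ (- q) q≤p)

[1+p]-[1+q]≡p-q : ∀ p q → (1ℚ + p) - (1ℚ + q) ≡ p - q
[1+p]-[1+q]≡p-q = solve 2 (λ p q → (con 1ℚ :+ p) :- (con 1ℚ :+ q) := p :- q) refl

sumℚ-mono-≤ : ∀ {n} {f g : Fin n → ℚ} → (∀ k → f k ≤ℚ g k) → sumℚ f ≤ℚ sumℚ g
sumℚ-mono-≤ {zero}  f≤g = ℚP.≤-refl
sumℚ-mono-≤ {suc n} f≤g = ℚP.+-mono-≤ (f≤g zero) (sumℚ-mono-≤ (λ k → f≤g (suc k)))

sumℚ-mono-< : ∀ {n} {f g : Fin n → ℚ} → (∀ k → f k ≤ℚ g k) → ∀ j → f j <ℚ g j →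
  sumℚ f <ℚ sumℚ g
sumℚ-mono-< {suc n} f≤g zero    fj<gj = ℚP.+-mono-<-≤ fj<gj (sumℚ-mono-≤ (λ k → f≤g (suc k)))
sumℚ-mono-< {suc n} f≤g (suc j) fj<gj =
  ℚP.+-mono-≤-< (f≤g zero) (sumℚ-mono-< (λ k → f≤g (suc k)) j fj<gj)

sumℚ-cong : ∀ {n} {f g : Fin n → ℚ} → (∀ k → f k ≡ g k) → sumℚ f ≡ sumℚ g
sumℚ-cong {zero}  f≡g = refl
sumℚ-cong {suc n} f≡g = cong₂ _+_ (f≡g zero) (sumℚ-cong (λ k → f≡g (suc k)))

sumℚ-*ʳ : ∀ {n} (f : Fin n → ℚ) q → sumℚ (λ k → f k * q) ≡ sumℚ f * q
sumℚ-*ʳ {zero}  f q = sym (ℚP.*-zeroˡ q)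
sumℚ-*ʳ {suc n} f q = trans (cong ((f zero * q) +_) (sumℚ-*ʳ (λ k → f (suc k)) q))
  (sym (ℚP.*-distribʳ-+ q (f zero) (sumℚ (λ k → f (suc k)))))

sumℚ-- : ∀ {n} (f g : Fin n → ℚ) → sumℚ (λ k → f k - g k) ≡ sumℚ f - sumℚ g
sumℚ-- {zero}  f g = refl
sumℚ-- {suc n} f g = begin
  (f zero - g zero) + sumℚ (λ k → f (suc k) - g (suc k))
    ≡⟨ cong ((f zero - g zero) +_) (sumℚ-- (λ k → f (suc k)) (λ k → g (suc k))) ⟩
  (f zero - g zero) + (sumℚ (λ k → f (suc k)) - sumℚ (λ k → g (suc k)))
    ≡⟨ solve 4 (λ a b s t → (a :- b) :+ (s :- t) := (a :+ s) :- (b :+ t)) refl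
         (f zero) (g zero) (sumℚ (λ k → f (suc k))) (sumℚ (λ k → g (suc k))) ⟩
  sumℚ f - sumℚ g ∎
  where open ≡-Reasoning

sumℚ-if : ∀ {n} (b : Fin n → Bool) q →
  sumℚ (λ k → if b k then q else 0ℚ) ≡ fromℕ (countℕ b) * q
sumℚ-if {zero}  b q = sym (ℚP.*-zeroˡ q)
sumℚ-if {suc n} b q with b zero
... | true  = begin
  q + sumℚ (λ k → if b (suc k) then q else 0ℚ)
    ≡⟨ cong₂ _+_ (sym (ℚP.*-identityˡ q)) (sumℚ-if (λ k → b (suc k)) q) ⟩
  1ℚ * q + fromℕ c * q  ≡⟨ ℚP.*-distribʳ-+ q 1ℚ (fromℕ c) ⟨
  (1ℚ + fromℕ c) * q    ≡⟨ cong (_* q) (fromℕ-suc c) ⟨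
  fromℕ (suc c) * q     ∎
  where
  open ≡-Reasoning
  c = countℕ (λ k → b (suc k))
... | false = trans (ℚP.+-identityˡ _) (sumℚ-if (λ k → b (suc k)) q)

countℕ-true : ∀ {n} (b : Fin n → Bool) {j} → b j ≡ true → ∃ λ c → countℕ b ≡ suc c
countℕ-true {suc n} b {zero}  b₀ rewrite b₀ = _ , refl
countℕ-true {suc n} b {suc j} bj with b zero
... | true  = _ , refl
... | false = countℕ-true (λ k → b (suc k)) bj

average : ∀ {N} → Graph N → (Fin N → ℚ) → Fin N → ℚ
average G e i = sumℚ (λ k → trans-prob G i k * e k)

Superharmonic-outside : ∀ {N} → Graph N → Subset N → (Fin N → ℚ) → Set
Superharmonic-outside G B e = ∀ i → i ∉ B → average G e i ≤ℚ e i

module _ {N : ℕ} (G : Graph N) where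

  trans-prob-nonNeg : ∀ i k → 0ℚ ≤ℚ trans-prob G i k
  trans-prob-nonNeg i k with G i k
  ... | true  = invDeg-nonNeg (degree G i)
  ... | false = ℚP.≤-refl

  trans-prob-pos : ∀ {i j} → G i j ≡ true → 0ℚ <ℚ trans-prob G i j
  trans-prob-pos {i} gij with countℕ-true (G i) gij
  ... | c , deg≡ rewrite gij | deg≡ = invDeg-pos c

  trans-prob-sum : ∀ {i j} → G i j ≡ true → sumℚ (trans-prob G i) ≡ 1ℚ
  trans-prob-sum {i} gij with countℕ-true (G i) gij
  ... | c , deg≡ = begin
    sumℚ (trans-prob G i)                     ≡⟨ sumℚ-if (G i) (invDeg (degree G i)) ⟩
    fromℕ (degree G i) * invDeg (degree G i)  ≡⟨ cong (λ d → fromℕ d * invDeg d) deg≡ ⟩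
    fromℕ (suc c) * invDeg (suc c)            ≡⟨ fromℕ*invDeg c ⟩
    1ℚ                                        ∎
    where open ≡-Reasoning

  average-const : ∀ {i j} → G i j ≡ true → ∀ m → average G (λ _ → m) i ≡ m
  average-const {i} gij m = begin
    sumℚ (λ k → trans-prob G i k * m)  ≡⟨ sumℚ-*ʳ (trans-prob G i) m ⟩
    sumℚ (trans-prob G i) * m          ≡⟨ cong (_* m) (trans-prob-sum gij) ⟩
    1ℚ * m                             ≡⟨ ℚP.*-identityˡ m ⟩
    m                                  ∎
    where open ≡-Reasoning

  average-- : ∀ (f g : Fin N → ℚ) i →
    average G (λ k → f k - g k) i ≡ average G f i - average G g i
  average-- f g i = trans (sumℚ-cong λ k → *-distribˡ-- (trans-prob G i k) (f k) (g k))
    (sumℚ-- (λ k → trans-prob G i k * f k) (λ k → trans-prob G i k * g k))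
    where
    *-distribˡ-- : ∀ p x y → p * (x - y) ≡ p * x - p * y
    *-distribˡ-- = solve 3 (λ p x y → p :* (x :- y) := p :* x :- p :* y) refl

  average-strict : ∀ {i j} → G i j ≡ true → ∀ {m} (e : Fin N → ℚ) →
    (∀ k → m ≤ℚ e k) → m <ℚ e j → m <ℚ average G e i
  average-strict {i} {j} gij {m} e m≤e m<ej = subst (_<ℚ average G e i) (average-const gij m)
    (sumℚ-mono-< pm≤pe j
      (ℚP.*-monoʳ-<-pos (trans-prob G i j) {{ℚ.positive (trans-prob-pos gij)}} m<ej))
    where
    pm≤pe : ∀ k → trans-prob G i k * m ≤ℚ trans-prob G i k * e k
    pm≤pe k = ℚP.*-monoˡ-≤-nonNeg (trans-prob G i k)
      {{ℚ.nonNegative (trans-prob-nonNeg i k)}} (m≤e k)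

  minimum-principle : Connected G → ∀ {B} → Nonempty B → (e : Fin N → ℚ) →
    (∀ j → j ∈ B → 0ℚ ≤ℚ e j) → Superharmonic-outside G B e → ∀ k → 0ℚ ≤ℚ e k
  minimum-principle conn {B} (b , b∈B) e e≥0 superharmonic k =
    ℚP.≤-trans (ℚP.≮⇒≥ (λ min<0 → no-walk min<0 (proj₂ (conn i₀ b)) ℚP.≤-refl)) (min≤ k)
    where
    i₀ : Fin N
    i₀ = argmin e b (allFin N)
    min≤ : ∀ k → e i₀ ≤ℚ e k
    min≤ k = All.lookup (f[argmin]≤f[xs] b (allFin N)) (∈-allFin k)
    -- Strict averaging keeps a walk from the minimiser at the minimum; it must reach B.
    no-walk : e i₀ <ℚ 0ℚ → ∀ {i n} → Walk G i b n → e i ≤ℚ e i₀ → ⊥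
    no-walk min<0 {i} w ei≤min with i ∈? B | w
    ... | yes i∈B | _   = ℚP.<-irrefl refl (ℚP.≤-<-trans (ℚP.≤-trans (e≥0 i i∈B) ei≤min) min<0)
    ... | no  i∉B | nil = i∉B b∈B
    ... | no  i∉B | cons {j = j} gij w′ with e j ℚP.≤? e i₀
    ...   | yes ej≤min = no-walk min<0 w′ ej≤min
    ...   | no  ej≰min = ℚP.<-irrefl refl
            (ℚP.<-≤-trans (average-strict gij e min≤ (ℚP.≰⇒> ej≰min))
                          (ℚP.≤-trans (superharmonic i i∉B) ei≤min))

hit₀ : ∀ {N} → (Subset N → Fin N → ℚ) → Subset N → Fin N → ℚ
hit₀ h A j = if lookup A j then 0ℚ else h A j

module _ {N : ℕ} (h : Subset N → Fin N → ℚ) {A : Subset N} where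

  hit₀-∈ : ∀ {j} → j ∈ A → hit₀ h A j ≡ 0ℚ
  hit₀-∈ j∈A rewrite []=⇒lookup j∈A = refl

  hit₀-∉ : ∀ {j} → j ∉ A → hit₀ h A j ≡ h A j
  hit₀-∉ {j} j∉A with lookup A j in eq
  ... | true  = ⊥-elim (j∉A (lookup⇒[]= j A eq))
  ... | false = refl

module _ {N : ℕ} {G : Graph N} (conn : Connected G)
         {h : Subset N → Fin N → ℚ} (hit : IsHittingTime G h) where

  hit₀-step : ∀ {A} → Nonempty A → ∀ {i} → i ∉ A → hit₀ h A i ≡ 1ℚ + average G (hit₀ h A) i
  hit₀-step neA {i} i∉A = trans (hit₀-∉ h i∉A) (hit _ neA i i∉A)

  hit₀-nonNeg : ∀ {A} → Nonempty A → ∀ k → 0ℚ ≤ℚ hit₀ h A k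
  hit₀-nonNeg {A} neA = minimum-principle G conn neA (hit₀ h A)
    (λ j j∈A → ℚP.≤-reflexive (sym (hit₀-∈ h j∈A)))
    (λ i i∉A → subst (average G (hit₀ h A) i ≤ℚ_) (sym (hit₀-step neA i∉A)) (p≤1+p _))
    where
    p≤1+p : ∀ p → p ≤ℚ 1ℚ + p
    p≤1+p p = subst (_≤ℚ 1ℚ + p) (ℚP.+-identityˡ p) (ℚP.+-monoˡ-≤ p (ℚP.nonNegative⁻¹ 1ℚ))

  hit₀-antitone : ∀ {A B} → Nonempty A → A ⊆ B → ∀ k → hit₀ h B k ≤ℚ hit₀ h A k
  hit₀-antitone {A} {B} neA@(a , a∈A) A⊆B k =
    0≤p-q⇒q≤p (minimum-principle G conn neB d d-on-B d-harmonic k)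
    where
    neB : Nonempty B
    neB = a , A⊆B a∈A
    d : Fin N → ℚ
    d k = hit₀ h A k - hit₀ h B k
    d-on-B : ∀ j → j ∈ B → 0ℚ ≤ℚ d j
    d-on-B j j∈B = subst (λ x → 0ℚ ≤ℚ hit₀ h A j - x) (sym (hit₀-∈ h j∈B))
      (subst (0ℚ ≤ℚ_) (sym (ℚP.+-identityʳ (hit₀ h A j))) (hit₀-nonNeg neA j))
    d-harmonic : Superharmonic-outside G B d
    d-harmonic i i∉B = ℚP.≤-reflexive (begin
      average G d i          ≡⟨ average-- G (hit₀ h A) (hit₀ h B) i ⟩
      PA - PB                ≡⟨ [1+p]-[1+q]≡p-q PA PB ⟨
      (1ℚ + PA) - (1ℚ + PB)  ≡⟨ cong₂ _-_ (hit₀-step neA (i∉B ∘ A⊆B)) (hit₀-step neB i∉B) ⟨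
      d i                    ∎)
      where
      open ≡-Reasoning
      PA = average G (hit₀ h A) i
      PB = average G (hit₀ h B) i

  Fsum-antitone : ∀ {A B} → Nonempty A → A ⊆ B → Fsum h B ≤ℚ Fsum h A
  Fsum-antitone neA A⊆B = sumℚ-mono-≤ (hit₀-antitone neA A⊆B)

IsMin≤IsMax : ∀ {N C} {F : Subset N → ℚ} {Fmax Fmin} →
  IsMax C F Fmax → IsMin C F Fmin → Fmin ≤ℚ Fmax
IsMin≤IsMax {Fmax = Fmax} (_ , ≤max) ((A , admissible , FA≡min) , _) =
  subst (_≤ℚ Fmax) FA≡min (≤max A admissible)

rank-antitone : ∀ {N} (F : Subset N → ℚ) {Fmax Fmin} (ne : Fmax ≢ Fmin) → Fmin ≤ℚ Fmax →
  ∀ {A B} → F B ≤ℚ F A → rank F Fmax Fmin ne A ≤ℚ rank F Fmax Fmin ne B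
rank-antitone F {Fmax} {Fmin} ne Fmin≤Fmax {A} {B} FB≤FA =
  ℚP.*-monoʳ-≤-nonNeg (1/ D) {{ℚ.nonNegative 0≤1/D}}
    (ℚP.+-monoʳ-≤ Fmax (ℚP.neg-antimono-≤ FB≤FA))
  where
  D : ℚ
  D = Fmax - Fmin
  instance
    D≢0 : ℚ.NonZero D
    D≢0 = ℚ.≢-nonZero (diff≢0 ne)
    0≤D : NonNegative D
    0≤D = ℚ.nonNegative (q≤p⇒0≤p-q Fmin≤Fmax)
  0≤1/D : 0ℚ ≤ℚ 1/ D
  0≤1/D = ℚP.<⇒≤ (ℚP.positive⁻¹ _ {{ℚP.1/pos⇒pos D {{ℚP.nonNeg∧nonZero⇒pos D}}}})

∣p∪q∣≤∣p∣+∣q∣ : ∀ {n} (p q : Subset n) → ∣ p ∪ q ∣ ≤ ∣ p ∣ ℕ.+ ∣ q ∣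
∣p∪q∣≤∣p∣+∣q∣ []            []            = ℕ.z≤n
∣p∪q∣≤∣p∣+∣q∣ (inside  ∷ p) (inside  ∷ q) =
  ℕ.s≤s (ℕP.≤-trans (∣p∪q∣≤∣p∣+∣q∣ p q) (ℕP.+-monoʳ-≤ ∣ p ∣ (ℕP.n≤1+n ∣ q ∣)))
∣p∪q∣≤∣p∣+∣q∣ (inside  ∷ p) (outside ∷ q) = ℕ.s≤s (∣p∪q∣≤∣p∣+∣q∣ p q)
∣p∪q∣≤∣p∣+∣q∣ (outside ∷ p) (inside  ∷ q) =
  ℕP.≤-trans (ℕ.s≤s (∣p∪q∣≤∣p∣+∣q∣ p q)) (ℕP.≤-reflexive (sym (ℕP.+-suc ∣ p ∣ ∣ q ∣)))
∣p∪q∣≤∣p∣+∣q∣ (outside ∷ p) (outside ∷ q) = ∣p∪q∣≤∣p∣+∣q∣ p q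

∣p∣<∣q∣⇒∃∈q∉p : ∀ {n} {p q : Subset n} → ∣ p ∣ < ∣ q ∣ → ∃ λ x → x ∈ q × x ∉ p
∣p∣<∣q∣⇒∃∈q∉p {p = p} {q} ∣p∣<∣q∣ with any? (λ x → x ∈? q ×-dec ¬? (x ∈? p))
... | yes found = found
... | no  none  = ⊥-elim (ℕP.<⇒≱ ∣p∣<∣q∣ (p⊆q⇒∣p∣≤∣q∣ q⊆p))
  where
  q⊆p : q ⊆ p
  q⊆p {x} x∈q = decidable-stable (x ∈? p) (λ x∉p → none (x , x∈q , x∉p))

InL-augmentation : ∀ {N} (ρ : Subset N → ℚ) → (∀ {A B} → Nonempty A → A ⊆ B → ρ A ≤ℚ ρ B) →
  ∀ {c K X Y} → InL ρ c K X → InL ρ c K Y → ∣ Y ∣ < ∣ X ∣ →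
  ∃ λ x → x ∈ X × x ∉ Y × InL ρ c K (Y ∪ ⁅ x ⁆)
InL-augmentation ρ ρ-mono {K = K} {X} {Y} (_ , ∣X∣≤K , _) (neY , _ , c≤ρY) ∣Y∣<∣X∣
  with ∣p∣<∣q∣⇒∃∈q∉p ∣Y∣<∣X∣
... | x , x∈X , x∉Y = x , x∈X , x∉Y , (x , x∈p∪q⁺ (inj₂ (x∈⁅x⁆ x))) , size , c≤ρ
  where
  size : ∣ Y ∪ ⁅ x ⁆ ∣ ≤ K
  size = begin
    ∣ Y ∪ ⁅ x ⁆ ∣           ≤⟨ ∣p∪q∣≤∣p∣+∣q∣ Y ⁅ x ⁆ ⟩
    ∣ Y ∣ ℕ.+ ∣ ⁅ x ⁆ ∣     ≡⟨ cong (∣ Y ∣ ℕ.+_) (∣⁅x⁆∣≡1 x) ⟩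
    ∣ Y ∣ ℕ.+ 1             ≡⟨ ℕP.+-comm ∣ Y ∣ 1 ⟩
    suc ∣ Y ∣               ≤⟨ ∣Y∣<∣X∣ ⟩
    ∣ X ∣                   ≤⟨ ∣X∣≤K ⟩
    K                       ∎
    where open ℕP.≤-Reasoning
  c≤ρ : _ ≤ℚ ρ (Y ∪ ⁅ x ⁆)
  c≤ρ = ℚP.≤-trans c≤ρY (ρ-mono neY (p⊆p∪q ⁅ x ⁆))

proposition1 : (N : ℕ) (G : Graph N) → IsSimpleUndirected G → Connected G → Aperiodic G →
    (C : ℕ) (S : Subset N) → VertexCover G C S →
    (h : Subset N → Fin N → ℚ) → IsHittingTime G h →
    (Fmax Fmin : ℚ) → IsMax C (Fsum h) Fmax → IsMin C (Fsum h) Fmin →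
    (ne : Fmax ≢ Fmin) →
    (c : ℚ) → 0ℚ <ℚ c → c ≤ℚ 1ℚ →
    (K : ℕ) → 0 < K → K ≤ N →
    (X Y : Subset N) →
    InL (rank (Fsum h) Fmax Fmin ne) c K X →
    InL (rank (Fsum h) Fmax Fmin ne) c K Y →
    ∣ Y ∣ < ∣ X ∣ →
    ∃ λ (x : Fin N) → (x ∈ X) × (x ∉ Y) ×
      InL (rank (Fsum h) Fmax Fmin ne) c K (Y ∪ ⁅ x ⁆)
proposition1 _ _ _ conn _ _ _ _ h hit Fmax Fmin isMax isMin ne _ _ _ _ _ _ _ _ X∈L Y∈L ∣Y∣<∣X∣ =
  InL-augmentation (rank (Fsum h) Fmax Fmin ne) rank-monotone X∈L Y∈L ∣Y∣<∣X∣
  where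
  rank-monotone : ∀ {A B} → Nonempty A → A ⊆ B →
    rank (Fsum h) Fmax Fmin ne A ≤ℚ rank (Fsum h) Fmax Fmin ne B
  rank-monotone neA A⊆B =
    rank-antitone (Fsum h) ne (IsMin≤IsMax isMax isMin) (Fsum-antitone conn hit neA A⊆B)
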